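{- Let $G$ be a finite bipartite graph with color classes $A$ and $B$, and $b:V(G)\to\mathbb{Z}_{\ge0}$. Suppose $G$ is $b$-flexible connected and has a perfect $b$-matching $M$. Then (i) for any $x,y\in A$ there is an $M$-wedge path from $x$ to $y$; (ii) for any $x\in A$ and $y\in B$ there is an $M$-saturated path between $x$ and $y$; (iii) for any $x\in A$ and $y\in B$ there is an $M$-exposed path between $x$ and $y$.
   Context: $\delta_H(v)$: edges of graph $H$ at $v$. A $b$-matching is $M\subseteq E(G)$ with $|\delta_G(v)\cap M|\le b(v)$ for all $v$; maximum = largest cardinality; it is perfect if $|\delta_G(v)\cap M|=b(v)$ for all $v$. An edge is allowed if in some maximum $b$-matching; an allowed edge is inevitable if in every maximum $b$-matching, flexible otherwise. Flexible components: induced subgraphs $G[V(K)]$, $K$ a connected component of $(V(G),\{\text{flexible edges}\})$. $G$ is $b$-flexible connected if it has exactly one flexible component. Paths are subgraphs. A path $P$ with ends $x,y$ is $M$-wedge from $x$ to $y$ if $|\delta_P(v)\cap M|=1$ for $v\in V(P)\setminus\{y\}$ and $\delta_P(y)\cap M=\emptyset$; $M$-saturated between $x,y$ if $|\delta_P(v)\cap M|=1$ for all $v\in V(P)$; $M$-exposed between $x,y$ if $|\delta_P(v)\setminus M|=1$ for all $v\in V(P)$. -}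

module Defs where

open import Data.Nat using (ℕ; zero; suc; _+_; _≤_)
open import Data.Bool using (Bool; true; false; not; _∨_; _∧_)
open import Data.Fin using (Fin)
import Data.Fin as Fin
open import Data.Sum using (_⊎_; inj₁; inj₂)
open import Data.Sum.Properties using (≡-dec)
open import Data.Product using (Σ; ∃; _×_; _,_)
open import Data.List using (List; []; _∷_; allFin; map)
open import Data.Nat.ListAction using (sum)
open import Data.Empty using (⊥)
open import Relation.Nullary using (¬_; does)
open import Relation.Binary.PropositionalEquality using (_≡_)
open import Relation.Binary.Construct.Closure.ReflexiveTransitive using (Star)
open import Data.List.Relation.Unary.Linked using (Linked)
open import Data.List.Relation.Unary.Unique.Propositional using (Unique)

-- Finite simple bipartite graphs with colour classes A = Fin p, B = Fin q.
-- The edge {a,b} (a ∈ A, b ∈ B) is present iff adj a b ≡ true.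

record BipGraph : Set where
  field
    p q : ℕ
    adj : Fin p → Fin q → Bool
open BipGraph public

V : BipGraph → Set
V G = Fin (p G) ⊎ Fin (q G)

eqV : {G : BipGraph} → V G → V G → Bool
eqV u v = does (≡-dec Fin._≟_ Fin._≟_ u v)

count : {X : Set} → (X → Bool) → List X → ℕ
count f [] = 0
count f (x ∷ xs) with f x
... | true  = suc (count f xs)
... | false = count f xs

countFin : {n : ℕ} → (Fin n → Bool) → ℕ
countFin {n} f = count f (allFin n)

EdgeSet : BipGraph → Set
EdgeSet G = Fin (p G) → Fin (q G) → Bool

card : {G : BipGraph} → EdgeSet G → ℕ
card {G} M = sum (map (λ a → countFin (λ b → M a b)) (allFin (p G)))

degM : {G : BipGraph} → EdgeSet G → V G → ℕ
degM {G} M (inj₁ a) = countFin (λ b → M a b)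
degM {G} M (inj₂ b) = countFin (λ a → M a b)

IsBMatching : (G : BipGraph) → (V G → ℕ) → EdgeSet G → Set
IsBMatching G bv M =
  (∀ a c → M a c ≡ true → adj G a c ≡ true) × (∀ v → degM {G} M v ≤ bv v)

IsMaxBMatching : (G : BipGraph) → (V G → ℕ) → EdgeSet G → Set
IsMaxBMatching G bv M =
  IsBMatching G bv M × (∀ N → IsBMatching G bv N → card {G} N ≤ card {G} M)

IsPerfectBMatching : (G : BipGraph) → (V G → ℕ) → EdgeSet G → Set
IsPerfectBMatching G bv M = IsBMatching G bv M × (∀ v → degM {G} M v ≡ bv v)

Allowed : (G : BipGraph) → (V G → ℕ) → Fin (p G) → Fin (q G) → Set
Allowed G bv a c = adj G a c ≡ true ×
  Σ (EdgeSet G) (λ M → IsMaxBMatching G bv M × M a c ≡ true)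

Inevitable : (G : BipGraph) → (V G → ℕ) → Fin (p G) → Fin (q G) → Set
Inevitable G bv a c = Allowed G bv a c ×
  (∀ M → IsMaxBMatching G bv M → M a c ≡ true)

Flexible : (G : BipGraph) → (V G → ℕ) → Fin (p G) → Fin (q G) → Set
Flexible G bv a c = Allowed G bv a c × ¬ Inevitable G bv a c

FlexAdj : (G : BipGraph) → (V G → ℕ) → V G → V G → Set
FlexAdj G bv (inj₁ a) (inj₂ c) = Flexible G bv a c
FlexAdj G bv (inj₂ c) (inj₁ a) = Flexible G bv a c
FlexAdj G bv _ _ = ⊥

-- G is b-flexible connected: (V(G), {flexible edges}) has exactly one
-- connected component, i.e. V(G) is nonempty and any two vertices are
-- joined by a walk of flexible edges.
FlexConnected : (G : BipGraph) → (V G → ℕ) → Set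
FlexConnected G bv = V G × (∀ u v → Star (FlexAdj G bv) u v)

-- Paths (as subgraphs): a nonempty list of distinct vertices, consecutive
-- ones adjacent in G; its edges are the consecutive pairs.

Adj : (G : BipGraph) → V G → V G → Set
Adj G (inj₁ a) (inj₂ c) = adj G a c ≡ true
Adj G (inj₂ c) (inj₁ a) = adj G a c ≡ true
Adj G _ _ = ⊥

inM : {G : BipGraph} → EdgeSet G → V G → V G → Bool
inM M (inj₁ a) (inj₂ c) = M a c
inM M (inj₂ c) (inj₁ a) = M a c
inM M _ _ = false

pathEdges : {X : Set} → List X → List (X × X)
pathEdges [] = []
pathEdges (u ∷ []) = []
pathEdges (u ∷ w ∷ vs) = (u , w) ∷ pathEdges (w ∷ vs)

lastV : {X : Set} → X → List X → X
lastV x [] = x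
lastV x (y ∷ ys) = lastV y ys

record Path (G : BipGraph) (x y : V G) : Set where
  field
    rest   : List (V G)
    ends   : lastV x rest ≡ y
    linked : Linked (Adj G) (x ∷ rest)
    unique : Unique (x ∷ rest)
open Path public

verts : {G : BipGraph} {x y : V G} → Path G x y → List (V G)
verts {x = x} P = x ∷ rest P

edges : {G : BipGraph} {x y : V G} → Path G x y → List (V G × V G)
edges P = pathEdges (verts P)

_∈V_ : {G : BipGraph} {x y : V G} → V G → Path G x y → Set
_∈V_ {G} v P = count (eqV {G} v) (verts P) ≡ 1

incident : {G : BipGraph} → V G → V G × V G → Bool
incident {G} v (u , w) = eqV {G} v u ∨ eqV {G} v w

degPM : {G : BipGraph} {x y : V G} → EdgeSet G → Path G x y → V G → ℕ
degPM {G} M P v =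
  count (λ { (u , w) → incident {G} v (u , w) ∧ inM {G} M u w }) (edges P)

degPnotM : {G : BipGraph} {x y : V G} → EdgeSet G → Path G x y → V G → ℕ
degPnotM {G} M P v =
  count (λ { (u , w) → incident {G} v (u , w) ∧ not (inM {G} M u w) }) (edges P)

IsWedge : {G : BipGraph} {x y : V G} → EdgeSet G → Path G x y → Set
IsWedge {G} {x} {y} M P =
  (∀ v → v ∈V P → ¬ (v ≡ y) → degPM M P v ≡ 1) × degPM M P y ≡ 0

IsSaturated : {G : BipGraph} {x y : V G} → EdgeSet G → Path G x y → Set
IsSaturated M P = ∀ v → v ∈V P → degPM M P v ≡ 1

IsExposed : {G : BipGraph} {x y : V G} → EdgeSet G → Path G x y → Set
IsExposed M P = ∀ v → v ∈V P → degPnotM M P v ≡ 1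

module Submission where

open import Defs
open import Data.Nat using (ℕ)
open import Data.Fin using (Fin)
open import Data.Sum using (inj₁; inj₂)
open import Data.Product using (Σ; _×_)

open import Data.Bool using (Bool; true; false; not; _∧_; _∨_)
import Data.Bool as Bool
open import Data.Bool.Properties using (∧-comm; ∧-identityʳ; ∧-zeroʳ; ¬-not; not-involutive)
open import Data.Empty using (⊥; ⊥-elim)
open import Data.Fin using (zero; suc)
import Data.Fin as Fin
open import Data.Fin.Properties using (all?)
open import Data.List using (List; []; _∷_; _++_; map; allFin)
open import Data.List.Membership.Propositional using (_∈_)
open import Data.List.Membership.Propositional.Properties
  using (∈-map⁺; ∈-map⁻; ∈-++⁺ˡ; ∈-++⁺ʳ; ∈-allFin)
import Data.List.Membership.DecPropositional as DecMembership
open import Data.List.Properties using (map-cong; map-cong-local)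
open import Data.List.Relation.Unary.All as All using (All; []; _∷_)
open import Data.List.Relation.Unary.All.Properties.Core using (¬Any⇒All¬)
open import Data.List.Relation.Unary.AllPairs using ([]; _∷_)
open import Data.List.Relation.Unary.Any using (here; there)
open import Data.List.Relation.Unary.Linked as Linked using (Linked; [-]; _∷_)
open import Data.List.Relation.Unary.Unique.Propositional using (Unique)
import Data.List.Relation.Unary.Unique.Propositional.Properties as Unique
open import Data.Nat using (zero; suc; _+_; _≤_; _<_; z≤n; s≤s; _≤?_)
open import Data.Nat.ListAction using (sum)
open import Data.Nat.Properties
open import Algebra.Properties.CommutativeSemigroup +-commutativeSemigroup using (interchange)
open import Data.Product using (∃; _,_; proj₁; proj₂)
open import Data.Sum using ([_,_])
open import Data.Sum.Properties using (≡-dec; inj₁-injective; inj₂-injective)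
import Data.Vec.Functional as VF
open import Function using (_∘_; id)
open import Relation.Binary.Construct.Closure.ReflexiveTransitive
  using (Star; ε; _◅_; _◅◅_; kleisliStar; reverse)
open import Relation.Binary.Definitions using (DecidableEquality)
open import Relation.Binary.PropositionalEquality
  using (_≡_; _≢_; refl; sym; trans; cong; cong₂; subst; subst₂; ≢-sym; module ≡-Reasoning)
open import Relation.Nullary using (¬_; Dec; yes; no; does)
open import Relation.Nullary.Decidable using (map′; _×-dec_; _→-dec_; dec-true; dec-false)

-- Direct every edge ac of G (a ∈ A, c ∈ B) from a to c if it lies in M and
-- from c to a otherwise.  Walks in this alternating digraph D alternate
-- between M-edges (leaving A) and non-M-edges (leaving B).  The theorem
-- follows from two facts.
--
-- (1) D is strongly connected.  Take a flexible edge ac; some maximum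
--     b-matching N differs from M on it.  Since |N| ≥ |M| and M is perfect,
--     the arcs of D in the symmetric difference of M and N have in-degree at
--     least out-degree at every vertex, and in such a finite digraph every
--     arc lies on a closed walk.  So ac is traversed in both directions, and
--     flexible connectivity joins any two vertices.
-- (2) A shortest D-walk from x to y is a path of G, and the number of M-edges
--     of the path at a vertex v is [v ∈ A, v ≠ y] + [v ∈ B, v ≠ x]; the same
--     count holds for non-M-edges on a walk of the reversed digraph.

bit : Bool → ℕ
bit true  = 1
bit false = 0

count-∷ : {X : Set} (f : X → Bool) (x : X) (xs : List X) →
  count f (x ∷ xs) ≡ bit (f x) + count f xs
count-∷ f x xs with f x
... | true  = refl
... | false = refl

count≡sum : {X : Set} (f : X → Bool) (xs : List X) →
  count f xs ≡ sum (map (bit ∘ f) xs)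
count≡sum f []       = refl
count≡sum f (x ∷ xs) = trans (count-∷ f x xs) (cong (bit (f x) +_) (count≡sum f xs))

count-cong : {X : Set} {f g : X → Bool} → (∀ x → f x ≡ g x) →
  (xs : List X) → count f xs ≡ count g xs
count-cong f≗g []                = refl
count-cong {f = f} {g} f≗g (x ∷ xs) = begin
  count f (x ∷ xs)        ≡⟨ count-∷ f x xs ⟩
  bit (f x) + count f xs  ≡⟨ cong₂ _+_ (cong bit (f≗g x)) (count-cong f≗g xs) ⟩
  bit (g x) + count g xs  ≡⟨ count-∷ g x xs ⟨
  count g (x ∷ xs)        ∎
  where open ≡-Reasoning

count-false : {X : Set} (xs : List X) → count (λ _ → false) xs ≡ 0
count-false []       = refl
count-false (x ∷ xs) = count-false xs

count-++ : {X : Set} (f : X → Bool) (xs ys : List X) →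
  count f (xs ++ ys) ≡ count f xs + count f ys
count-++ f []       ys = refl
count-++ f (x ∷ xs) ys = begin
  count f (x ∷ xs ++ ys)                 ≡⟨ count-∷ f x (xs ++ ys) ⟩
  bit (f x) + count f (xs ++ ys)         ≡⟨ cong (bit (f x) +_) (count-++ f xs ys) ⟩
  bit (f x) + (count f xs + count f ys)  ≡⟨ +-assoc (bit (f x)) _ _ ⟨
  (bit (f x) + count f xs) + count f ys  ≡⟨ cong (_+ count f ys) (count-∷ f x xs) ⟨
  count f (x ∷ xs) + count f ys          ∎
  where open ≡-Reasoning

count-map : {X Y : Set} (f : Y → Bool) (g : X → Y) (xs : List X) →
  count f (map g xs) ≡ count (f ∘ g) xs
count-map f g []       = refl
count-map f g (x ∷ xs) = begin
  count f (g x ∷ map g xs)            ≡⟨ count-∷ f (g x) (map g xs) ⟩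
  bit (f (g x)) + count f (map g xs)  ≡⟨ cong (bit (f (g x)) +_) (count-map f g xs) ⟩
  bit (f (g x)) + count (f ∘ g) xs    ≡⟨ count-∷ (f ∘ g) x xs ⟨
  count (f ∘ g) (x ∷ xs)              ∎
  where open ≡-Reasoning

count-witness : {X : Set} (f : X → Bool) (xs : List X) → 0 < count f xs →
  ∃ λ x → x ∈ xs × f x ≡ true
count-witness f (x ∷ xs) pos with f x in fx
... | true  = x , here refl , fx
... | false with count-witness f xs pos
...   | y , y∈xs , fy = y , there y∈xs , fy

count-split : {X : Set} (f g : X → Bool) (xs : List X) →
  count f xs ≡ count (λ x → f x ∧ g x) xs + count (λ x → f x ∧ not (g x)) xs
count-split f g []       = refl
count-split {X} f g (x ∷ xs) = begin
  count f (x ∷ xs)                          ≡⟨ count-∷ f x xs ⟩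
  bit (f x) + count f xs                    ≡⟨ cong₂ _+_ (bit-split (f x) (g x)) (count-split f g xs) ⟩
  (bit (f x ∧ g x) + bit (f x ∧ not (g x))) + (count f∧g xs + count f∧¬g xs)
                                            ≡⟨ interchange (bit (f x ∧ g x)) _ _ _ ⟩
  (bit (f x ∧ g x) + count f∧g xs) + (bit (f x ∧ not (g x)) + count f∧¬g xs)
                                            ≡⟨ cong₂ _+_ (count-∷ f∧g x xs) (count-∷ f∧¬g x xs) ⟨
  count f∧g (x ∷ xs) + count f∧¬g (x ∷ xs)  ∎
  where
  open ≡-Reasoning
  f∧g f∧¬g : X → Bool
  f∧g  y = f y ∧ g y
  f∧¬g y = f y ∧ not (g y)
  bit-split : ∀ u v → bit u ≡ bit (u ∧ v) + bit (u ∧ not v)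
  bit-split true  true  = refl
  bit-split true  false = refl
  bit-split false v     = refl

-- If f is counted at most as often as g, then "f but not g" is counted at
-- most as often as "g but not f" (both sides share the part "f and g").
count-difference-≤ : {X : Set} (f g : X → Bool) (xs : List X) → count f xs ≤ count g xs →
  count (λ x → f x ∧ not (g x)) xs ≤ count (λ x → g x ∧ not (f x)) xs
count-difference-≤ f g xs f≤g = +-cancelˡ-≤ (count (λ x → f x ∧ g x) xs) _ _ (begin
  count (λ x → f x ∧ g x) xs + count (λ x → f x ∧ not (g x)) xs ≡⟨ count-split f g xs ⟨
  count f xs                                                    ≤⟨ f≤g ⟩
  count g xs                                                    ≡⟨ count-split g f xs ⟩
  count (λ x → g x ∧ f x) xs + count (λ x → g x ∧ not (f x)) xs
    ≡⟨ cong (_+ count (λ x → g x ∧ not (f x)) xs) (count-cong (λ x → ∧-comm (g x) (f x)) xs) ⟩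
  count (λ x → f x ∧ g x) xs + count (λ x → g x ∧ not (f x)) xs ∎)
  where open ≤-Reasoning

sum-decrement : {X : Set} {f g : X → ℕ} {x₀ : X} {xs : List X} → Unique xs → x₀ ∈ xs →
  (∀ x → x ≢ x₀ → f x ≡ g x) → suc (f x₀) ≡ g x₀ →
  suc (sum (map f xs)) ≡ sum (map g xs)
sum-decrement (x₀∉xs ∷ _) (here refl) others at-x₀ =
  cong₂ _+_ at-x₀ (cong sum (map-cong-local (All.map (λ x₀≢y → others _ (≢-sym x₀≢y)) x₀∉xs)))
sum-decrement {f = f} {x₀ = x₀} {x ∷ xs} (x∉xs ∷ unique) (there x₀∈xs) others at-x₀ =
  trans (sym (+-suc (f x) _))
        (cong₂ _+_ (others x (All.lookup x∉xs x₀∈xs)) (sum-decrement unique x₀∈xs others at-x₀))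

count-decrement : {X : Set} {f g : X → Bool} {x₀ : X} {xs : List X} → Unique xs → x₀ ∈ xs →
  (∀ x → x ≢ x₀ → f x ≡ g x) → f x₀ ≡ false → g x₀ ≡ true →
  suc (count f xs) ≡ count g xs
count-decrement {f = f} {g} {xs = xs} unique x₀∈xs others fx₀ gx₀ = begin
  suc (count f xs)               ≡⟨ cong suc (count≡sum f xs) ⟩
  suc (sum (map (bit ∘ f) xs))   ≡⟨ sum-decrement unique x₀∈xs (λ x ne → cong bit (others x ne))
                                      (subst₂ (λ u v → suc (bit u) ≡ bit v) (sym fx₀) (sym gx₀) refl) ⟩
  sum (map (bit ∘ g) xs)         ≡⟨ count≡sum g xs ⟨
  count g xs                     ∎
  where open ≡-Reasoning

sum-mono : {X : Set} {f g : X → ℕ} → (∀ x → f x ≤ g x) → (xs : List X) →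
  sum (map f xs) ≤ sum (map g xs)
sum-mono f≤g []       = z≤n
sum-mono f≤g (x ∷ xs) = +-mono-≤ (f≤g x) (sum-mono f≤g xs)

sum-rigid : {X : Set} {f g : X → ℕ} → (∀ x → f x ≤ g x) → (xs : List X) →
  sum (map g xs) ≤ sum (map f xs) → All (λ x → f x ≡ g x) xs
sum-rigid f≤g []       _    = []
sum-rigid {f = f} {g} f≤g (x ∷ xs) g≤f =
  ≤-antisym (f≤g x) gx≤fx ∷ sum-rigid f≤g xs rest-g≤f
  where
  Sf Sg : ℕ
  Sf = sum (map f xs)
  Sg = sum (map g xs)
  gx≤fx : g x ≤ f x
  gx≤fx = +-cancelʳ-≤ Sg _ _ (≤-trans g≤f (+-monoʳ-≤ (f x) (sum-mono f≤g xs)))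
  rest-g≤f : Sg ≤ Sf
  rest-g≤f = +-cancelˡ-≤ (g x) _ _ (≤-trans g≤f (+-monoˡ-≤ Sf (f≤g x)))

-- The vertex type X is enumerated without repetition by the
-- list xs; a finite arc set is a Boolean matrix R whose arcs all belong to a
-- fixed relation Arc.

module FiniteDigraph {X : Set} (_≟_ : DecidableEquality X) (xs : List X)
  (xs-unique : Unique xs) (xs-complete : ∀ x → x ∈ xs) (Arc : X → X → Set) where

  ArcSet : Set
  ArcSet = X → X → Bool

  outdeg indeg : ArcSet → X → ℕ
  outdeg R u = count (R u) xs
  indeg  R v = count (λ u → R u v) xs

  size : ArcSet → ℕ
  size R = sum (map (outdeg R) xs)

  _⊆Arc : ArcSet → Set
  R ⊆Arc = ∀ {u v} → R u v ≡ true → Arc u v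

  without : ArcSet → X → X → ArcSet
  without R u₀ v₀ u v = R u v ∧ not (does (u ≟ u₀) ∧ does (v ≟ v₀))

  module Removal (R : ArcSet) (u₀ v₀ : X) where

    without-⊆ : ∀ {u v} → without R u₀ v₀ u v ≡ true → R u v ≡ true
    without-⊆ {u} {v} _ with R u v
    without-⊆ ()           | false
    without-⊆ _            | true = refl

    without-source : ∀ {u} v → u ≢ u₀ → without R u₀ v₀ u v ≡ R u v
    without-source {u} v u≢u₀ with u ≟ u₀
    ... | yes u≡u₀ = ⊥-elim (u≢u₀ u≡u₀)
    ... | no _     = ∧-identityʳ (R u v)

    without-target : ∀ u {v} → v ≢ v₀ → without R u₀ v₀ u v ≡ R u v
    without-target u {v} v≢v₀ with u ≟ u₀ | v ≟ v₀
    ... | _     | yes v≡v₀ = ⊥-elim (v≢v₀ v≡v₀)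
    ... | yes _ | no _     = ∧-identityʳ (R u v)
    ... | no _  | no _     = ∧-identityʳ (R u v)

    without-removes : without R u₀ v₀ u₀ v₀ ≡ false
    without-removes with u₀ ≟ u₀ | v₀ ≟ v₀
    ... | yes _ | yes _   = ∧-zeroʳ (R u₀ v₀)
    ... | no ne | _       = ⊥-elim (ne refl)
    ... | yes _ | no ne   = ⊥-elim (ne refl)

    outdeg-without-other : ∀ {u} → u ≢ u₀ → outdeg (without R u₀ v₀) u ≡ outdeg R u
    outdeg-without-other u≢u₀ = count-cong (λ v → without-source v u≢u₀) xs

    indeg-without-other : ∀ {v} → v ≢ v₀ → indeg (without R u₀ v₀) v ≡ indeg R v
    indeg-without-other v≢v₀ = count-cong (λ u → without-target u v≢v₀) xs

    module _ (arc : R u₀ v₀ ≡ true) where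

      outdeg-without : suc (outdeg (without R u₀ v₀) u₀) ≡ outdeg R u₀
      outdeg-without = count-decrement xs-unique (xs-complete v₀)
        (λ v v≢v₀ → without-target u₀ v≢v₀) without-removes arc

      indeg-without : suc (indeg (without R u₀ v₀) v₀) ≡ indeg R v₀
      indeg-without = count-decrement xs-unique (xs-complete u₀)
        (λ u u≢u₀ → without-source v₀ u≢u₀) without-removes arc

      size-without : suc (size (without R u₀ v₀)) ≡ size R
      size-without = sum-decrement xs-unique (xs-complete u₀)
        (λ u u≢u₀ → outdeg-without-other u≢u₀) outdeg-without

  -- Walk backwards
  -- from t along an arc of R entering it and remove that arc; the tail of the
  -- removed arc becomes the new deficient vertex.
  reach-deficient : (R : ArcSet) → R ⊆Arc → (s t : X) →
    (∀ v → v ≢ s → v ≢ t → outdeg R v ≤ indeg R v) →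
    (t ≢ s → outdeg R t < indeg R t) →
    Star Arc s t
  reach-deficient R = go (suc (size R)) R ≤-refl
    where
    go : ∀ k (R : ArcSet) → size R < k → R ⊆Arc → (s t : X) →
      (∀ v → v ≢ s → v ≢ t → outdeg R v ≤ indeg R v) →
      (t ≢ s → outdeg R t < indeg R t) →
      Star Arc s t
    go zero    R ()
    go (suc k) R size<k R⊆Arc s t balanced deficient with t ≟ s
    ... | yes refl = ε
    ... | no t≢s with count-witness (λ u → R u t) xs (≤-trans (s≤s z≤n) (deficient t≢s))
    ...   | u , _ , arc = go k R′ size′<k (R⊆Arc ∘ without-⊆) s u balanced′ deficient′
                          ◅◅ (R⊆Arc arc ◅ ε)
      where
      open Removal R u t
      R′ : ArcSet
      R′ = without R u t
      size′<k : size R′ < k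
      size′<k = subst (_≤ k) (sym (size-without arc)) (≤-pred size<k)
      balanced′ : ∀ v → v ≢ s → v ≢ u → outdeg R′ v ≤ indeg R′ v
      balanced′ v v≢s v≢u = by-cases (v ≟ t)
        where
        by-cases : Dec (v ≡ t) → outdeg R′ v ≤ indeg R′ v
        by-cases (yes refl) = subst (_≤ indeg R′ v) (sym (outdeg-without-other v≢u))
                         (≤-pred (subst (suc (outdeg R v) ≤_) (sym (indeg-without arc)) (deficient t≢s)))
        by-cases (no v≢t) = subst₂ _≤_ (sym (outdeg-without-other v≢u))
          (sym (indeg-without-other v≢t)) (balanced v v≢s v≢t)
      deficient′ : u ≢ s → outdeg R′ u < indeg R′ u
      deficient′ u≢s = by-cases (u ≟ t)
        where
        by-cases : Dec (u ≡ t) → outdeg R′ u < indeg R′ u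
        by-cases (yes refl) = ≤-pred (subst₂ _≤_ (sym (cong suc (outdeg-without arc))) (sym (indeg-without arc))
                         (deficient t≢s))
        by-cases (no u≢t) = subst₂ _≤_ (sym (outdeg-without arc))
          (sym (indeg-without-other u≢t)) (balanced u u≢s u≢t)

  -- In a balanced arc set every arc u → v can be closed to a cycle: there is
  -- a walk from v back to u.  Remove the arc; then u is deficient.
  arc-on-cycle : (R : ArcSet) → R ⊆Arc → (∀ v → outdeg R v ≤ indeg R v) →
    ∀ {u v} → R u v ≡ true → Star Arc v u
  arc-on-cycle R R⊆Arc balanced {u} {v} arc =
    reach-deficient (without R u v) (R⊆Arc ∘ Removal.without-⊆ R u v) v u balanced′ deficient′
    where
    open Removal R u v
    balanced′ : ∀ w → w ≢ v → w ≢ u → outdeg (without R u v) w ≤ indeg (without R u v) w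
    balanced′ w w≢v w≢u = subst₂ _≤_ (sym (outdeg-without-other w≢u)) (sym (indeg-without-other w≢v))
      (balanced w)
    deficient′ : u ≢ v → outdeg (without R u v) u < indeg (without R u v) u
    deficient′ u≢v = subst₂ _≤_ (sym (outdeg-without arc)) (sym (indeg-without-other u≢v)) (balanced u)

-- Boolean matrices are searchable; this is what turns "the edge is not
-- inevitable" into an explicit b-matching differing from M on the edge.

Searchable : (A : Set) → (A → A → Set) → Set₁
Searchable A _≈_ = (P : A → Set) → (∀ {x y} → x ≈ y → P x → P y) →
  (∀ x → Dec (P x)) → Dec (∃ P)

bool-searchable : Searchable Bool _≡_
bool-searchable P _ P? with P? true | P? false
... | yes pt | _      = yes (true , pt)
... | no _   | yes pf = yes (false , pf)
... | no ¬pt | no ¬pf = no λ { (true , pt) → ¬pt pt ; (false , pf) → ¬pf pf }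

Fin→-searchable : {A : Set} (_≈_ : A → A → Set) → (∀ {x} → x ≈ x) → Searchable A _≈_ →
  ∀ n → Searchable (Fin n → A) (λ f g → ∀ i → f i ≈ g i)
Fin→-searchable _≈_ ≈-refl search-A zero P P-resp P? with P? (λ ())
... | yes p = yes (_ , p)
... | no ¬p = no λ { (f , pf) → ¬p (P-resp (λ ()) pf) }
Fin→-searchable {A} _≈_ ≈-refl search-A (suc n) P P-resp P? =
  map′ (λ { (x , g , p) → (x VF.∷ g) , p })
       (λ { (f , p) → VF.head f , VF.tail f , P-resp (λ { zero → ≈-refl ; (suc i) → ≈-refl }) p })
       (search-A HasTail HasTail-resp HasTail?)
  where
  HasTail : A → Set
  HasTail x = ∃ λ g → P (x VF.∷ g)
  HasTail-resp : ∀ {x y} → x ≈ y → HasTail x → HasTail y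
  HasTail-resp x≈y (g , p) = g , P-resp (λ { zero → x≈y ; (suc i) → ≈-refl }) p
  HasTail? : ∀ x → Dec (HasTail x)
  HasTail? x = Fin→-searchable _≈_ ≈-refl search-A n (λ g → P (x VF.∷ g))
    (λ g≈g′ → P-resp (λ { zero → ≈-refl ; (suc i) → g≈g′ i })) (λ g → P? (x VF.∷ g))

_≗ₑ_ : {G : BipGraph} → EdgeSet G → EdgeSet G → Set
_≗ₑ_ {G} N N′ = ∀ a c → N a c ≡ N′ a c

edgeSets-searchable : (G : BipGraph) → Searchable (EdgeSet G) (_≗ₑ_ {G})
edgeSets-searchable G =
  Fin→-searchable _ (λ _ → refl) (Fin→-searchable _≡_ refl bool-searchable (q G)) (p G)

AltArc : (G : BipGraph) → EdgeSet G → V G → V G → Set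
AltArc G L (inj₁ a) (inj₂ c) = adj G a c ≡ true × L a c ≡ true
AltArc G L (inj₂ c) (inj₁ a) = adj G a c ≡ true × L a c ≡ false
AltArc G L _        _        = ⊥

_≟V_ : {G : BipGraph} → DecidableEquality (V G)
_≟V_ = ≡-dec Fin._≟_ Fin._≟_

vertices : (G : BipGraph) → List (V G)
vertices G = map inj₁ (allFin (p G)) ++ map inj₂ (allFin (q G))

vertices-unique : (G : BipGraph) → Unique (vertices G)
vertices-unique G = Unique.++⁺ (Unique.map⁺ inj₁-injective (Unique.allFin⁺ _))
  (Unique.map⁺ inj₂-injective (Unique.allFin⁺ _)) A∩B=∅
  where
  A∩B=∅ : ∀ {v} → ¬ (v ∈ map inj₁ (allFin (p G)) × v ∈ map inj₂ (allFin (q G)))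
  A∩B=∅ (v∈A , v∈B) with ∈-map⁻ inj₁ v∈A | ∈-map⁻ inj₂ v∈B
  ... | _ , _ , refl | _ , _ , ()

vertices-complete : (G : BipGraph) → ∀ v → v ∈ vertices G
vertices-complete G (inj₁ a) = ∈-++⁺ˡ (∈-map⁺ inj₁ (∈-allFin a))
vertices-complete G (inj₂ c) = ∈-++⁺ʳ _ (∈-map⁺ inj₂ (∈-allFin c))

count-only-B : (G : BipGraph) (f : V G → Bool) → (∀ a → f (inj₁ a) ≡ false) →
  count f (vertices G) ≡ countFin (f ∘ inj₂)
count-only-B G f never-A = begin
  count f (vertices G)
    ≡⟨ count-++ f (map inj₁ (allFin (p G))) _ ⟩
  count f (map inj₁ (allFin (p G))) + count f (map inj₂ (allFin (q G)))
    ≡⟨ cong₂ _+_ (trans (count-map f inj₁ (allFin (p G))) (count-cong never-A (allFin (p G))))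
                   (count-map f inj₂ (allFin (q G))) ⟩
  count (λ _ → false) (allFin (p G)) + countFin (f ∘ inj₂)
    ≡⟨ cong (_+ countFin (f ∘ inj₂)) (count-false (allFin (p G))) ⟩
  countFin (f ∘ inj₂) ∎
  where open ≡-Reasoning

count-only-A : (G : BipGraph) (f : V G → Bool) → (∀ c → f (inj₂ c) ≡ false) →
  count f (vertices G) ≡ countFin (f ∘ inj₁)
count-only-A G f never-B = begin
  count f (vertices G)
    ≡⟨ count-++ f (map inj₁ (allFin (p G))) _ ⟩
  count f (map inj₁ (allFin (p G))) + count f (map inj₂ (allFin (q G)))
    ≡⟨ cong₂ _+_ (count-map f inj₁ (allFin (p G)))
                   (trans (count-map f inj₂ (allFin (q G))) (count-cong never-B (allFin (q G)))) ⟩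
  countFin (f ∘ inj₁) + count (λ _ → false) (allFin (q G))
    ≡⟨ cong (countFin (f ∘ inj₁) +_) (count-false (allFin (q G))) ⟩
  countFin (f ∘ inj₁) + 0
    ≡⟨ +-identityʳ _ ⟩
  countFin (f ∘ inj₁) ∎
  where open ≡-Reasoning

isBMatching? : (G : BipGraph) (b : V G → ℕ) (N : EdgeSet G) → Dec (IsBMatching G b N)
isBMatching? G b N =
  all? (λ a → all? (λ c → (N a c Bool.≟ true) →-dec (adj G a c Bool.≟ true)))
  ×-dec map′ (λ { (on-A , on-B) → [ on-A , on-B ] }) (λ bounded → bounded ∘ inj₁ , bounded ∘ inj₂)
             (all? (λ a → degM {G} N (inj₁ a) ≤? b (inj₁ a))
              ×-dec all? (λ c → degM {G} N (inj₂ c) ≤? b (inj₂ c)))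

module _ {G : BipGraph} {N N′ : EdgeSet G} (N≗N′ : _≗ₑ_ {G} N N′) where

  degM-cong : ∀ v → degM {G} N v ≡ degM {G} N′ v
  degM-cong (inj₁ a) = count-cong (N≗N′ a) (allFin (q G))
  degM-cong (inj₂ c) = count-cong (λ a → N≗N′ a c) (allFin (p G))

  card-cong : card {G} N ≡ card {G} N′
  card-cong = cong sum (map-cong (λ a → count-cong (N≗N′ a) (allFin (q G))) (allFin (p G)))

  isBMatching-cong : ∀ {b} → IsBMatching G b N → IsBMatching G b N′
  isBMatching-cong {b} (N⊆E , N≤b) =
    (λ a c N′ac → N⊆E a c (trans (N≗N′ a c) N′ac)) , (λ v → subst (_≤ b v) (degM-cong v) (N≤b v))

and-not : ∀ {x y} → x ∧ not y ≡ true → x ≡ true × y ≡ false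
and-not {true} {false} _ = refl , refl

module PerfectMatching (G : BipGraph) (b : V G → ℕ) (M : EdgeSet G)
  (perfect : IsPerfectBMatching G b M) where

  open FiniteDigraph (_≟V_ {G}) (vertices G) (vertices-unique G) (vertices-complete G) (AltArc G M)

  M⊆E : ∀ {a c} → M a c ≡ true → adj G a c ≡ true
  M⊆E = proj₁ (proj₁ perfect) _ _

  AsLarge : EdgeSet G → Set
  AsLarge N = IsBMatching G b N × card {G} M ≤ card {G} N

  -- Every vertex has N-degree at most b(v), which is its M-degree; since the
  -- A-degrees sum to |N| ≥ |M|, the A-degrees of N and M agree.
  degree-≤ : ∀ {N} → IsBMatching G b N → ∀ v → degM {G} N v ≤ degM {G} M v
  degree-≤ {N} (_ , N≤b) v = subst (degM {G} N v ≤_) (sym (proj₂ perfect v)) (N≤b v)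

  A-degrees-agree : ∀ {N} → AsLarge N → ∀ a → degM {G} N (inj₁ a) ≡ degM {G} M (inj₁ a)
  A-degrees-agree (N-matching , |M|≤|N|) a =
    All.lookup (sum-rigid (degree-≤ N-matching ∘ inj₁) (allFin (p G)) |M|≤|N|) (∈-allFin a)

  -- The arcs of the alternating digraph lying in the symmetric difference of
  -- M and N.  When N is as large as M, every vertex has in-degree at least its
  -- out-degree here (with equality on A).
  symDiff : EdgeSet G → ArcSet
  symDiff N (inj₁ a) (inj₂ c) = M a c ∧ not (N a c)
  symDiff N (inj₂ c) (inj₁ a) = N a c ∧ not (M a c)
  symDiff N _        _        = false

  symDiff-⊆ : ∀ {N} → IsBMatching G b N → symDiff N ⊆Arc
  symDiff-⊆ _ {inj₁ a} {inj₂ c} arc = let (Mac , _) = and-not arc in M⊆E Mac , Mac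
  symDiff-⊆ (N⊆E , _) {inj₂ c} {inj₁ a} arc = let (Nac , Mac) = and-not arc in N⊆E a c Nac , Mac
  symDiff-⊆ _ {inj₁ _} {inj₁ _} ()
  symDiff-⊆ _ {inj₂ _} {inj₂ _} ()

  symDiff-balanced : ∀ {N} → AsLarge N → ∀ v → outdeg (symDiff N) v ≤ indeg (symDiff N) v
  symDiff-balanced {N} large (inj₁ a) =
    subst₂ _≤_ (sym (count-only-B G _ (λ _ → refl))) (sym (count-only-B G _ (λ _ → refl)))
      (count-difference-≤ (M a) (N a) (allFin (q G)) (≤-reflexive (sym (A-degrees-agree large a))))
  symDiff-balanced {N} (N-matching , _) (inj₂ c) =
    subst₂ _≤_ (sym (count-only-A G _ (λ _ → refl))) (sym (count-only-A G _ (λ _ → refl)))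
      (count-difference-≤ (λ a → N a c) (λ a → M a c) (allFin (p G)) (degree-≤ N-matching (inj₂ c)))

  -- An edge on which M and an as-large b-matching N differ is traversed in
  -- both directions by walks of the alternating digraph: one direction is the
  -- edge itself, the other closes the corresponding arc of symDiff N to a cycle.
  differing-edge-walks : ∀ {N a c} → AsLarge N → N a c ≡ not (M a c) →
    Star (AltArc G M) (inj₁ a) (inj₂ c) × Star (AltArc G M) (inj₂ c) (inj₁ a)
  differing-edge-walks {N} {a} {c} large@(N-matching , _) differs with M a c in Mac
  ... | true  = (M⊆E Mac , Mac) ◅ ε ,
                arc-on-cycle (symDiff N) (symDiff-⊆ N-matching) (symDiff-balanced large)
                  (cong₂ (λ x y → x ∧ not y) Mac differs)
  ... | false = arc-on-cycle (symDiff N) (symDiff-⊆ N-matching) (symDiff-balanced large)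
                  (cong₂ (λ x y → x ∧ not y) differs Mac) ,
                (proj₁ N-matching a c differs , Mac) ◅ ε

  -- A flexible edge is in some but not in every maximum b-matching, so some
  -- b-matching as large as M differs from M on it.  The witness is found by
  -- exhaustive search; if none existed, all maximum b-matchings would agree
  -- with M on the edge, making it inevitable.
  flexible-edge-differs : ∀ {a c} → Flexible G b a c → ∃ λ N → AsLarge N × N a c ≡ not (M a c)
  flexible-edge-differs {a} {c} (allowed@(_ , N₁ , N₁-max , N₁ac) , not-inevitable)
    with edgeSets-searchable G Differs Differs-cong Differs?
    where
    Differs : EdgeSet G → Set
    Differs N = AsLarge N × N a c ≡ not (M a c)
    Differs-cong : ∀ {N N′} → _≗ₑ_ {G} N N′ → Differs N → Differs N′
    Differs-cong {N} {N′} N≗N′ ((N-matching , |M|≤|N|) , differs) =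
      (isBMatching-cong {G} {N} {N′} N≗N′ {b} N-matching ,
       subst (card {G} M ≤_) (card-cong {G} {N} {N′} N≗N′) |M|≤|N|) ,
      trans (sym (N≗N′ a c)) differs
    Differs? : ∀ N → Dec (Differs N)
    Differs? N = (isBMatching? G b N ×-dec card {G} M ≤? card {G} N) ×-dec (N a c Bool.≟ not (M a c))
  ... | yes found = found
  ... | no none   = ⊥-elim (not-inevitable (allowed , inevitable))
    where
    agrees : ∀ N → IsMaxBMatching G b N → N a c ≡ M a c
    agrees N (N-matching , N-max) with N a c Bool.≟ M a c
    ... | yes agree = agree
    ... | no differ = ⊥-elim (none (N , (N-matching , N-max M (proj₁ perfect)) , ¬-not differ))
    inevitable : ∀ N → IsMaxBMatching G b N → N a c ≡ true
    inevitable N N-max = trans (agrees N N-max) (trans (sym (agrees N₁ N₁-max)) N₁ac)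

  flexible-edge-walk : ∀ {u v} → FlexAdj G b u v → Star (AltArc G M) u v
  flexible-edge-walk {inj₁ a} {inj₂ c} flexible =
    let (_ , large , differs) = flexible-edge-differs flexible in
    proj₁ (differing-edge-walks large differs)
  flexible-edge-walk {inj₂ c} {inj₁ a} flexible =
    let (_ , large , differs) = flexible-edge-differs flexible in
    proj₂ (differing-edge-walks large differs)

  strongly-connected : FlexConnected G b → ∀ u v → Star (AltArc G M) u v
  strongly-connected (_ , flex-connected) u v =
    kleisliStar (id {A = V G}) flexible-edge-walk (flex-connected u v)

-- Simple paths.  A walk in a relation R can be shortened to a walk without
-- repeated vertices: when the first vertex reappears later, cut out the loop.

module SimplePaths {X : Set} (_≟_ : DecidableEquality X) (R : X → X → Set) where

  open DecMembership _≟_ using (_∈?_)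

  record SimplePath (u v : X) : Set where
    field
      rest   : List X
      ends   : lastV u rest ≡ v
      linked : Linked R (u ∷ rest)
      unique : Unique (u ∷ rest)

  suffix-from : ∀ {u v x} (xs : List X) → lastV x xs ≡ v → Linked R (x ∷ xs) → Unique (x ∷ xs) →
    u ∈ (x ∷ xs) → SimplePath u v
  suffix-from xs ends linked unique (here refl) = record
    { rest = xs ; ends = ends ; linked = linked ; unique = unique }
  suffix-from (y ∷ ys) ends linked (_ ∷ unique) (there u∈ys) =
    suffix-from ys ends (Linked.tail linked) unique u∈ys

  shorten : ∀ {u v} → Star R u v → SimplePath u v
  shorten ε = record { rest = [] ; ends = refl ; linked = [-] ; unique = [] ∷ [] }
  shorten {u} (_◅_ {j = x} step walk) with shorten walk
  ... | record { rest = xs ; ends = ends ; linked = linked ; unique = unique } with u ∈? (x ∷ xs)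
  ...   | yes u∈walk = suffix-from xs ends linked unique u∈walk
  ...   | no  u∉walk = record
          { rest = x ∷ xs ; ends = ends ; linked = step ∷ linked
          ; unique = ¬Any⇒All¬ (x ∷ xs) u∉walk ∷ unique }

lastV-∈ : {X : Set} (x : X) (xs : List X) → lastV x xs ∈ (x ∷ xs)
lastV-∈ x []       = here refl
lastV-∈ x (y ∷ ys) = there (lastV-∈ y ys)

-- Fix a Boolean label ψ on ordered pairs of
-- vertices of G.  A step u → w alternates if it crosses from one side to the
-- other and is labelled exactly when it leaves A.  On a simple path of such
-- steps from x to y, a vertex v meets a labelled edge towards its successor
-- iff v ∈ A and v ≠ y, and one from its predecessor iff v ∈ B and v ≠ x.

module AlternatingPaths (G : BipGraph) where

  inA inB : V G → Bool
  inA (inj₁ _) = true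
  inA (inj₂ _) = false
  inB v = not (inA v)

  Alternates : (V G → V G → Bool) → V G → V G → Set
  Alternates ψ u w = ψ u w ≡ inA u × inA w ≡ inB u

  labelled-at : (V G → V G → Bool) → V G → V G × V G → Bool
  labelled-at ψ v (u , w) = incident {G} v (u , w) ∧ ψ u w

  -- labelled edges of a path at v: towards the successor, from the predecessor
  leaves enters : V G → V G → ℕ
  leaves v y = bit (inA v ∧ not (eqV {G} v y))
  enters v x = bit (inB v ∧ not (eqV {G} v x))

  eqV-refl : ∀ v → eqV {G} v v ≡ true
  eqV-refl v = dec-true (_≟V_ {G} v v) refl

  eqV-≢ : ∀ {u v} → u ≢ v → eqV {G} u v ≡ false
  eqV-≢ {u} {v} u≢v = dec-false (_≟V_ {G} u v) u≢v

  eqV-true : ∀ {u v} → eqV {G} u v ≡ true → u ≡ v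
  eqV-true {u} {v} = from-does (_≟V_ {G} u v)
    where
    from-does : (u≟v : Dec (u ≡ v)) → does u≟v ≡ true → u ≡ v
    from-does (yes u≡v) _ = u≡v

  leaves-self : ∀ v → leaves v v ≡ 0
  leaves-self v = trans (cong (λ e → bit (inA v ∧ not e)) (eqV-refl v)) (cong bit (∧-zeroʳ (inA v)))

  enters-self : ∀ v → enters v v ≡ 0
  enters-self v = trans (cong (λ e → bit (inB v ∧ not e)) (eqV-refl v)) (cong bit (∧-zeroʳ (inB v)))

  leaves-other : ∀ {v y} → v ≢ y → leaves v y ≡ bit (inA v)
  leaves-other {v} v≢y =
    trans (cong (λ e → bit (inA v ∧ not e)) (eqV-≢ v≢y)) (cong bit (∧-identityʳ (inA v)))

  enters-other : ∀ {v x} → v ≢ x → enters v x ≡ bit (inB v)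
  enters-other {v} v≢x =
    trans (cong (λ e → bit (inB v ∧ not e)) (eqV-≢ v≢x)) (cong bit (∧-identityʳ (inB v)))

  absent-degree : ∀ ψ {v} vs → All (v ≢_) vs → count (labelled-at ψ v) (pathEdges vs) ≡ 0
  absent-degree ψ []           _                      = refl
  absent-degree ψ (x ∷ [])     _                      = refl
  absent-degree ψ {v} (x ∷ y ∷ vs) (v≢x ∷ v≢y ∷ v∉vs) = begin
    count (labelled-at ψ v) ((x , y) ∷ pathEdges (y ∷ vs))
      ≡⟨ count-∷ (labelled-at ψ v) (x , y) _ ⟩
    bit ((eqV {G} v x ∨ eqV {G} v y) ∧ ψ x y) + count (labelled-at ψ v) (pathEdges (y ∷ vs))
      ≡⟨ cong₂ (λ e f → bit ((e ∨ f) ∧ ψ x y) + count (labelled-at ψ v) (pathEdges (y ∷ vs)))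
             (eqV-≢ v≢x) (eqV-≢ v≢y) ⟩
    count (labelled-at ψ v) (pathEdges (y ∷ vs))
      ≡⟨ absent-degree ψ (y ∷ vs) (v≢y ∷ v∉vs) ⟩
    0 ∎
    where open ≡-Reasoning

  degree-at-start : ∀ ψ {x y} ys → All (x ≢_) (y ∷ ys) → ψ x y ≡ inA x →
    count (labelled-at ψ x) (pathEdges (x ∷ y ∷ ys)) ≡ leaves x (lastV y ys) + enters x x
  degree-at-start ψ {x} {y} ys x∉ys ψxy = begin
    count (labelled-at ψ x) ((x , y) ∷ pathEdges (y ∷ ys))
      ≡⟨ count-∷ (labelled-at ψ x) (x , y) _ ⟩
    bit ((eqV {G} x x ∨ eqV {G} x y) ∧ ψ x y) + count (labelled-at ψ x) (pathEdges (y ∷ ys))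
      ≡⟨ cong₂ (λ e f → bit ((e ∨ eqV {G} x y) ∧ f) + count (labelled-at ψ x) (pathEdges (y ∷ ys)))
             (eqV-refl x) ψxy ⟩
    bit (inA x) + count (labelled-at ψ x) (pathEdges (y ∷ ys))
      ≡⟨ cong (bit (inA x) +_) (absent-degree ψ (y ∷ ys) x∉ys) ⟩
    bit (inA x) + 0
      ≡⟨ cong₂ _+_ (leaves-other (All.lookup x∉ys (lastV-∈ y ys))) (enters-self x) ⟨
    leaves x (lastV y ys) + enters x x ∎
    where open ≡-Reasoning

  -- Prepending an alternating step x → y to a path does not change the
  -- labelled degree of a vertex v ≠ x, except that y gains the labelled edge
  -- from its predecessor exactly when y ∈ B: in both cases the "enters" term
  -- relative to the new start x is obtained.
  degree-after-step : ∀ ψ {x y v} ys → v ≢ x → Alternates ψ x y → ∀ L →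
    count (labelled-at ψ v) (pathEdges (y ∷ ys)) ≡ L + enters v y →
    count (labelled-at ψ v) (pathEdges (x ∷ y ∷ ys)) ≡ L + enters v x
  degree-after-step ψ {x} {y} {v} ys v≢x (ψxy , sides) L tail-degree = by-cases (_≟V_ {G} v y)
    where
    open ≡-Reasoning
    first-edge : labelled-at ψ v (x , y) ≡ (eqV {G} v y ∧ ψ x y)
    first-edge = cong (λ e → (e ∨ eqV {G} v y) ∧ ψ x y) (eqV-≢ v≢x)
    by-cases : Dec (v ≡ y) → count (labelled-at ψ v) (pathEdges (x ∷ y ∷ ys)) ≡ L + enters v x
    by-cases (yes refl) = begin
      count (labelled-at ψ v) ((x , v) ∷ pathEdges (v ∷ ys))
        ≡⟨ count-∷ (labelled-at ψ v) (x , v) _ ⟩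
      bit (labelled-at ψ v (x , v)) + count (labelled-at ψ v) (pathEdges (v ∷ ys))
        ≡⟨ cong₂ _+_ (cong bit (trans first-edge (cong (_∧ ψ x v) (eqV-refl v)))) tail-degree ⟩
      bit (ψ x v) + (L + enters v v)
        ≡⟨ cong₂ (λ e f → bit e + (L + f)) x∈A⇔v∈B (enters-self v) ⟩
      bit (inB v) + (L + 0)
        ≡⟨ cong (bit (inB v) +_) (+-identityʳ L) ⟩
      bit (inB v) + L
        ≡⟨ +-comm (bit (inB v)) L ⟩
      L + bit (inB v)
        ≡⟨ cong (L +_) (enters-other v≢x) ⟨
      L + enters v x ∎
      where
      x∈A⇔v∈B : ψ x v ≡ inB v
      x∈A⇔v∈B = begin
        ψ x v               ≡⟨ ψxy ⟩
        inA x               ≡⟨ not-involutive (inA x) ⟨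
        not (not (inA x))   ≡⟨ cong not sides ⟨
        inB v               ∎
    by-cases (no v≢y) = begin
      count (labelled-at ψ v) ((x , y) ∷ pathEdges (y ∷ ys))
        ≡⟨ count-∷ (labelled-at ψ v) (x , y) _ ⟩
      bit (labelled-at ψ v (x , y)) + count (labelled-at ψ v) (pathEdges (y ∷ ys))
        ≡⟨ cong₂ _+_ (cong bit (trans first-edge (cong (_∧ ψ x y) (eqV-≢ v≢y)))) tail-degree ⟩
      L + enters v y
        ≡⟨ cong (L +_) (trans (enters-other v≢y) (sym (enters-other v≢x))) ⟩
      L + enters v x ∎

  alternating-degree : ∀ ψ {x} rest {v} → Unique (x ∷ rest) → Linked (Alternates ψ) (x ∷ rest) →
    v ∈ (x ∷ rest) → count (labelled-at ψ v) (pathEdges (x ∷ rest)) ≡ leaves v (lastV x rest) + enters v x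
  alternating-degree ψ {x} [] _ _ (here refl) = sym (cong₂ _+_ (leaves-self x) (enters-self x))
  alternating-degree ψ (y ∷ ys) (x∉ys ∷ _) ((ψxy , _) ∷ _) (here refl) =
    degree-at-start ψ ys x∉ys ψxy
  alternating-degree ψ (y ∷ ys) (x∉ys ∷ unique) (step ∷ linked) (there v∈ys) =
    degree-after-step ψ ys (≢-sym (All.lookup x∉ys v∈ys)) step _
      (alternating-degree ψ ys unique linked v∈ys)

  alternating-path : {R : V G → V G → Set} (ψ : V G → V G → Bool) →
    (∀ {u w} → R u w → Adj G u w) → (∀ {u w} → R u w → Alternates ψ u w) →
    ∀ {x y} → Star R x y →
    Σ (Path G x y) λ P → ∀ v → v ∈ verts P →
      count (labelled-at ψ v) (edges P) ≡ leaves v y + enters v x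
  alternating-path {R} ψ adjacent alternates {x} walk = from-simple (shorten walk)
    where
    open SimplePaths (_≟V_ {G}) R
    from-simple : ∀ {y} → SimplePath x y → Σ (Path G x y) λ P → ∀ v → v ∈ verts P →
      count (labelled-at ψ v) (edges P) ≡ leaves v y + enters v x
    from-simple record { rest = xs ; ends = refl ; linked = linked ; unique = unique } =
      record { rest = xs ; ends = refl ; linked = Linked.map adjacent linked ; unique = unique } ,
      λ v → alternating-degree ψ xs unique (Linked.map alternates linked)

  occurs⇒∈ : ∀ {v} vs → count (eqV {G} v) vs ≡ 1 → v ∈ vs
  occurs⇒∈ {v} vs once with count-witness (eqV {G} v) vs (subst (0 <_) (sym once) (s≤s z≤n))
  ... | u , u∈vs , v≟u = subst (_∈ vs) (sym (eqV-true v≟u)) u∈vs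

  arc-adjacent : ∀ {L u w} → AltArc G L u w → Adj G u w
  arc-adjacent {u = inj₁ a} {inj₂ c} (a~c , _) = a~c
  arc-adjacent {u = inj₂ c} {inj₁ a} (a~c , _) = a~c

  reversed-arc-adjacent : ∀ {L u w} → AltArc G L w u → Adj G u w
  reversed-arc-adjacent {u = inj₁ a} {inj₂ c} (a~c , _) = a~c
  reversed-arc-adjacent {u = inj₂ c} {inj₁ a} (a~c , _) = a~c

  arc-alternates : ∀ {L u w} → AltArc G L u w → Alternates (inM {G} L) u w
  arc-alternates {u = inj₁ a} {inj₂ c} (_ , Lac) = Lac , refl
  arc-alternates {u = inj₂ c} {inj₁ a} (_ , Lac) = Lac , refl

  reversed-arc-alternates : ∀ {L u w} → AltArc G L w u →
    Alternates (λ u′ w′ → not (inM {G} L u′ w′)) u w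
  reversed-arc-alternates {u = inj₁ a} {inj₂ c} (_ , Lac) = cong not Lac , refl
  reversed-arc-alternates {u = inj₂ c} {inj₁ a} (_ , Lac) = cong not Lac , refl

  formula-A-B : ∀ {x y} v → leaves v (inj₂ y) + enters v (inj₁ x) ≡ 1
  formula-A-B (inj₁ a) = refl
  formula-A-B (inj₂ c) = refl

  formula-A-A : ∀ {x y} v → v ≢ inj₁ y → leaves v (inj₁ y) + enters v (inj₁ x) ≡ 1
  formula-A-A (inj₁ a) v≢y = cong (_+ 0) (leaves-other v≢y)
  formula-A-A (inj₂ c) _   = refl

  formula-A-A-end : ∀ {x} y → leaves (inj₁ y) (inj₁ y) + enters (inj₁ y) (inj₁ x) ≡ 0
  formula-A-A-end y = cong (_+ 0) (leaves-self (inj₁ y))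

module _ {G : BipGraph} (M : EdgeSet G) {x y : V G} (P : Path G x y) (v : V G) where
  open AlternatingPaths G

  degPM≡ : degPM M P v ≡ count (labelled-at (inM {G} M) v) (edges P)
  degPM≡ = count-cong (λ { (u , w) → refl }) (edges P)

  degPnotM≡ : degPnotM M P v ≡ count (labelled-at (λ u w → not (inM {G} M u w)) v) (edges P)
  degPnotM≡ = count-cong (λ { (u , w) → refl }) (edges P)

-- By flexible connectivity the alternating digraph of M is strongly
-- connected.  Shortening a walk in it from x to y gives a path on which every
-- A-vertex except y has its M-edge towards its successor and every B-vertex
-- its M-edge from its predecessor: an M-wedge when y ∈ A, M-saturated when
-- y ∈ B.  Shortening the reverse of a walk from y to x gives the same count
-- for non-M-edges: an M-exposed path.
mainTheorem16 : (G : BipGraph) (b : V G → ℕ) (M : EdgeSet G) →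
    FlexConnected G b → IsPerfectBMatching G b M →
    ((x y : Fin (p G)) → Σ (Path G (inj₁ x) (inj₁ y)) (λ P → IsWedge M P))
    × ((x : Fin (p G)) (y : Fin (q G)) →
    Σ (Path G (inj₁ x) (inj₂ y)) (λ P → IsSaturated M P))
    × ((x : Fin (p G)) (y : Fin (q G)) →
    Σ (Path G (inj₁ x) (inj₂ y)) (λ P → IsExposed M P))
mainTheorem16 G b M flex-connected perfect = wedge , saturated , exposed
  where
  open PerfectMatching G b M perfect using (strongly-connected)
  open AlternatingPaths G

  walk : ∀ u v → Star (AltArc G M) u v
  walk = strongly-connected flex-connected

  wedge : (x y : Fin (p G)) → Σ (Path G (inj₁ x) (inj₁ y)) (λ P → IsWedge M P)
  wedge x y with alternating-path (inM {G} M) arc-adjacent arc-alternates (walk (inj₁ x) (inj₁ y))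
  ... | P , degree =
    P , (λ v v∈P v≢y → trans (degPM≡ M P v)
                          (trans (degree v (occurs⇒∈ (verts P) v∈P)) (formula-A-A v v≢y))) ,
    trans (degPM≡ M P (inj₁ y)) (trans (degree (inj₁ y) y∈P) (formula-A-A-end {x} y))
    where
    y∈P : inj₁ y ∈ verts P
    y∈P = subst (_∈ verts P) (ends P) (lastV-∈ (inj₁ x) (rest P))

  saturated : (x : Fin (p G)) (y : Fin (q G)) → Σ (Path G (inj₁ x) (inj₂ y)) (λ P → IsSaturated M P)
  saturated x y with alternating-path (inM {G} M) arc-adjacent arc-alternates (walk (inj₁ x) (inj₂ y))
  ... | P , degree =
    P , λ v v∈P → trans (degPM≡ M P v) (trans (degree v (occurs⇒∈ (verts P) v∈P)) (formula-A-B v))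

  exposed : (x : Fin (p G)) (y : Fin (q G)) → Σ (Path G (inj₁ x) (inj₂ y)) (λ P → IsExposed M P)
  exposed x y with alternating-path (λ u w → not (inM {G} M u w)) reversed-arc-adjacent
                     reversed-arc-alternates (reverse id (walk (inj₂ y) (inj₁ x)))
  ... | P , degree =
    P , λ v v∈P → trans (degPnotM≡ M P v) (trans (degree v (occurs⇒∈ (verts P) v∈P)) (formula-A-B v))
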